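{- For any positive integers $p,k$, there exists a graph $G$ with $kp+k+2$ vertices and an integer-valued submodular function $f\colon 2^{V(G)} \rightarrow \mathbb{N}$ represented by a value oracle such that deciding whether ${\sf OPT}(G,f) = 2^{k+1}-2$ or ${\sf OPT}(G,f) = 2^{k+1}-1$ requires at least $p^k$ queries to the oracle.
   Context: ${\sf OPT}(G,f)=\min\{f(V(C))\colon C\text{ is a cycle of }G\}$. A function $f\colon 2^U\to\mathbb{R}$ is submodular if $f(X)+f(Y)\ge f(X\cup Y)+f(X\cap Y)$ for all $X,Y\subseteq U$. The function is accessible only through the oracle, which returns $f(X)$ on query $X$; the lower bound is on the number of queries needed in the worst case (over the possible functions the oracle may represent). -}

module Defs where

open import Data.Nat using (ℕ; zero; suc; _+_; _≤_)
open import Data.Bool using (Bool; true; false)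
open import Data.Fin using (Fin)
open import Data.Fin.Subset using (Subset; _∈_; _∪_; _∩_)
open import Data.List using (List; []; _∷_; length)
open import Data.List.Relation.Unary.Unique.Propositional using (Unique)
open import Data.List.Membership.Propositional renaming (_∈_ to _∈ᴸ_)
open import Data.Product using (Σ; _×_; ∃)
open import Data.Empty using (⊥)
open import Data.Unit using (⊤)
open import Relation.Binary.PropositionalEquality using (_≡_)
open import Function.Bundles using (_⇔_)

record Graph (n : ℕ) : Set₁ where
  field
    Adj     : Fin n → Fin n → Set
    Adj-sym : ∀ {u v} → Adj u v → Adj v u
    Adj-irr : ∀ {u} → Adj u u → ⊥

open Graph public

Path : ∀ {n} → Graph n → List (Fin n) → Set
Path G []           = ⊤
Path G (u ∷ [])     = ⊤
Path G (u ∷ v ∷ vs) = Adj G u v × Path G (v ∷ vs)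

last : ∀ {A : Set} → A → List A → A
last a []       = a
last a (b ∷ bs) = last b bs

Closes : ∀ {n} → Graph n → List (Fin n) → Set
Closes G []       = ⊥
Closes G (u ∷ vs) = Adj G (last u vs) u

IsCycle : ∀ {n} → Graph n → List (Fin n) → Set
IsCycle G vs = (3 ≤ length vs) × Unique vs × Path G vs × Closes G vs

IsCycleVertexSet : ∀ {n} → Graph n → Subset n → Set
IsCycleVertexSet {n} G S =
  Σ (List (Fin n)) λ vs → IsCycle G vs × (∀ x → (x ∈ S) ⇔ (x ∈ᴸ vs))

-- OPT(G,f) = v : the minimum of f(V(C)) over cycles C of G is attained and equals v.
IsOPT : ∀ {n} → Graph n → (Subset n → ℕ) → ℕ → Set
IsOPT {n} G f v =
  (Σ (Subset n) λ S → IsCycleVertexSet G S × f S ≡ v) ×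
  (∀ S → IsCycleVertexSet G S → v ≤ f S)

Submodular : ∀ {n} → (Subset n → ℕ) → Set
Submodular {n} f = ∀ (X Y : Subset n) → f (X ∪ Y) + f (X ∩ Y) ≤ f X + f Y

-- A deterministic adaptive value-oracle algorithm (decision tree):
-- either stop with a Boolean answer, or query f(X) and continue
-- depending on the returned value.
data Alg (n : ℕ) : Set where
  answer : Bool → Alg n
  query  : Subset n → (ℕ → Alg n) → Alg n

run : ∀ {n} → Alg n → (Subset n → ℕ) → Bool
run (answer b)  f = b
run (query X k) f = run (k (f X)) f

queries : ∀ {n} → Alg n → (Subset n → ℕ) → ℕ
queries (answer b)  f = 0
queries (query X k) f = suc (queries (k (f X)) f)

Decides : ∀ {n} → Graph n → ℕ → Alg n → Set
Decides {n} G L A = ∀ (f : Subset n → ℕ) → Submodular f →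
  (IsOPT G f L → run A f ≡ true) × (IsOPT G f (suc L) → run A f ≡ false)

{-# OPTIONS --safe #-}
module Submission where

-- The graph is a necklace: hubs h₀, …, h_k, consecutive hubs joined by p paths of length
-- two through distinct beads, and an apex adjacent to h₀ and h_k (k + 1 + k p + 1 vertices).
-- Giving h_i the potential 2i and its beads 2i + 1, a path from h₀ to h_k gains at most two
-- per bead, so every cycle through the apex has at least k beads; the p^k cycles choosing
-- one bead per level have exactly k. With Λ the set of beads and c + k = L + 1, let
-- f₀(X) = c + min(|X ∩ Λ|, k) when the apex is in X, and L + 1 + c + min(|X ∩ Λ|, k)
-- otherwise; then OPT(f₀) = L + 1. Lowering min(|W|, k) by one at a single k-set W = T
-- keeps it submodular (a relaxed uniform matroid rank), and doing so at the beads T of a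
-- canonical cycle gives OPT = L. These p^k functions agree with f₀ except on sets whose
-- bead part is their own T, so an algorithm querying f₀ fewer than p^k times misses one
-- of them and answers alike on f₀ and on it.

open import Defs

open import Algebra.Bundles using (CommutativeMonoid)
import Algebra.Properties.CommutativeSemigroup as CommutativeSemigroupProperties
open import Data.Bool using (Bool; true; false; not; _∨_; _∧_; if_then_else_)
open import Data.Bool.Properties using (T-≡; ∧-zeroʳ)
import Data.Bool.Properties as Bool
open import Data.Fin using (Fin; zero; suc; toℕ; fromℕ<; combine; funToFin; finToFun)
open import Data.Fin.Properties
  using (all?; ¬∀⟶∃¬; injective⇒≤; toℕ-fromℕ<; toℕ-injective; toℕ<n; funToFin-finToFin)
open import Data.Fin.Subset
  using (Subset; inside; outside; ⁅_⁆; ⋃; _∪_; _∩_; _-_; ∣_∣; _⊆_)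
  renaming (_∈_ to _∈ₛ_)
open import Data.Fin.Subset.Properties
open import Data.List using (List; []; _∷_; [_]; _++_; length; map; filter; allFin)
open import Data.List.Properties using (++-assoc; ++-identityʳ; length-map; map-cong; length-tabulate)
open import Data.List.Membership.Propositional using (_∈_)
open import Data.List.Membership.Propositional.Properties
  using (∈-∃++; ∈-map⁺; ∈-map⁻; ∈-filter⁻; ∈-allFin)
import Data.List.Membership.DecPropositional as DecMembership
import Data.List.Membership.Setoid.Properties as MembershipSetoid
open import Data.List.Relation.Binary.Permutation.Propositional using (_↭_; ↭⇒↭ₛ)
open import Data.List.Relation.Binary.Permutation.Propositional.Properties using (++-comm; ↭-length; map⁺)
import Data.List.Relation.Binary.Permutation.Setoid.Properties as PermutationSetoid
open import Data.List.Relation.Unary.All as All using (All; []; _∷_)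
import Data.List.Relation.Unary.All.Properties as All
open import Data.List.Relation.Unary.AllPairs using (AllPairs; []; _∷_)
open import Data.List.Relation.Unary.Any using (here; there; index)
open import Data.List.Relation.Unary.Unique.Propositional using (Unique)
import Data.List.Relation.Unary.Unique.Propositional.Properties as Unique
open import Data.Nat
  using (ℕ; zero; suc; _+_; _*_; _∸_; _^_; _⊓_; _/_; _%_; _≤_; _<_; z≤n; s≤s; z<s; s≤s⁻¹; _<?_; _≡ᵇ_; _<ᵇ_)
open import Data.Nat.DivMod using ([m+kn]%n≡m%n; m<n⇒m%n≡m; m*n%n≡0; m*n/n≡m; m<n⇒m/n≡0; +-distrib-/-∣ʳ)
open import Data.Nat.Divisibility using (divides-refl)
open import Data.Nat.ListAction using (sum)
open import Data.Nat.ListAction.Properties using (sum-↭)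
open import Data.Nat.Properties
open import Data.Nat.Tactic.RingSolver using (solve-∀)
open import Data.Product using (Σ; _×_; _,_; ∃; proj₁; proj₂)
open import Data.Sum using (_⊎_; inj₁; inj₂)
open import Data.Vec using ([]; _∷_; here; lookup; tabulate)
open import Data.Vec.Properties using (≡-dec; lookup-zipWith; lookup∘tabulate; []=⇒lookup; lookup⇒[]=)
open import Function using (id; _∘_; _⇔_; mk⇔; Equivalence; Injective)
open import Level using (0ℓ)
open import Relation.Binary using (DecidableEquality)
open import Relation.Binary.PropositionalEquality hiding ([_])
open import Relation.Nullary using (Dec; yes; no; does; contradiction; ¬_)
open import Relation.Unary using (Pred; Decidable)

private variable n : ℕ

setOf : List (Fin n) → Subset n
setOf xs = ⋃ (map ⁅_⁆ xs)

∈setOf⇔∈ : ∀ {x} (xs : List (Fin n)) → x ∈ₛ setOf xs ⇔ x ∈ xs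
∈setOf⇔∈ {x = x} xs = mk⇔ (to xs) (from xs)
  where
  to : ∀ xs → x ∈ₛ setOf xs → x ∈ xs
  to [] x∈⊥ = contradiction x∈⊥ ∉⊥
  to (y ∷ ys) x∈ with x∈p∪q⁻ ⁅ y ⁆ (setOf ys) x∈
  ... | inj₁ x∈⁅y⁆ = here (x∈⁅y⁆⇒x≡y y x∈⁅y⁆)
  ... | inj₂ x∈ys = there (to ys x∈ys)
  from : ∀ xs → x ∈ xs → x ∈ₛ setOf xs
  from (y ∷ ys) (here refl) = x∈p∪q⁺ (inj₁ (x∈⁅x⁆ x))
  from (y ∷ ys) (there x∈ys) = x∈p∪q⁺ (inj₂ (from ys x∈ys))

∣p∪q∣+∣p∩q∣≡∣p∣+∣q∣ : (p q : Subset n) → ∣ p ∪ q ∣ + ∣ p ∩ q ∣ ≡ ∣ p ∣ + ∣ q ∣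
∣p∪q∣+∣p∩q∣≡∣p∣+∣q∣ [] [] = refl
∣p∪q∣+∣p∩q∣≡∣p∣+∣q∣ (outside ∷ p) (outside ∷ q) = ∣p∪q∣+∣p∩q∣≡∣p∣+∣q∣ p q
∣p∪q∣+∣p∩q∣≡∣p∣+∣q∣ (inside ∷ p) (outside ∷ q) = cong suc (∣p∪q∣+∣p∩q∣≡∣p∣+∣q∣ p q)
∣p∪q∣+∣p∩q∣≡∣p∣+∣q∣ (outside ∷ p) (inside ∷ q) =
  trans (cong suc (∣p∪q∣+∣p∩q∣≡∣p∣+∣q∣ p q)) (sym (+-suc (∣ p ∣) (∣ q ∣)))
∣p∪q∣+∣p∩q∣≡∣p∣+∣q∣ (inside ∷ p) (inside ∷ q) =
  cong suc (trans (+-suc (∣ p ∪ q ∣) (∣ p ∩ q ∣))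
                  (trans (cong suc (∣p∪q∣+∣p∩q∣≡∣p∣+∣q∣ p q)) (sym (+-suc (∣ p ∣) (∣ q ∣)))))

∣p∪q∣≤∣p∣+∣q∣ : (p q : Subset n) → ∣ p ∪ q ∣ ≤ ∣ p ∣ + ∣ q ∣
∣p∪q∣≤∣p∣+∣q∣ p q = ≤-trans (m≤m+n (∣ p ∪ q ∣) (∣ p ∩ q ∣)) (≤-reflexive (∣p∪q∣+∣p∩q∣≡∣p∣+∣q∣ p q))

∣setOf∣≤length : (xs : List (Fin n)) → ∣ setOf xs ∣ ≤ length xs
∣setOf∣≤length {n} [] = ≤-reflexive (∣⊥∣≡0 n)
∣setOf∣≤length (x ∷ xs) = begin
  ∣ ⁅ x ⁆ ∪ setOf xs ∣       ≤⟨ ∣p∪q∣≤∣p∣+∣q∣ ⁅ x ⁆ (setOf xs) ⟩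
  ∣ ⁅ x ⁆ ∣ + ∣ setOf xs ∣   ≡⟨ cong (_+ ∣ setOf xs ∣) (∣⁅x⁆∣≡1 x) ⟩
  suc ∣ setOf xs ∣           ≤⟨ s≤s (∣setOf∣≤length xs) ⟩
  suc (length xs)            ∎
  where open ≤-Reasoning

⊆setOf⇒∣p∣≤length : ∀ {p : Subset n} (xs : List (Fin n)) →
                    (∀ {x} → x ∈ₛ p → x ∈ xs) → ∣ p ∣ ≤ length xs
⊆setOf⇒∣p∣≤length xs p⊆xs =
  ≤-trans (p⊆q⇒∣p∣≤∣q∣ (Equivalence.from (∈setOf⇔∈ xs) ∘ p⊆xs)) (∣setOf∣≤length xs)

unique⇒length≤∣p∣ : ∀ {p : Subset n} {xs : List (Fin n)} →
                    Unique xs → All (_∈ₛ p) xs → length xs ≤ ∣ p ∣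
unique⇒length≤∣p∣ [] [] = z≤n
unique⇒length≤∣p∣ {p = p} {x ∷ xs} (x∉xs ∷ unique) (x∈p ∷ xs⊆p) =
  ≤-trans (s≤s (unique⇒length≤∣p∣ unique xs⊆p-x)) (x∈p⇒∣p-x∣<∣p∣ x∈p)
  where
  xs⊆p-x : All (_∈ₛ p - x) xs
  xs⊆p-x = All.zipWith (λ (x≢y , y∈p) → x∈p∧x≢y⇒x∈p-y y∈p (x≢y ∘ sym)) (x∉xs , xs⊆p)

p⊆q∧p≢q⇒∣p∣<∣q∣ : ∀ {p q : Subset n} → p ⊆ q → p ≢ q → ∣ p ∣ < ∣ q ∣
p⊆q∧p≢q⇒∣p∣<∣q∣ {p = []} {[]} _ p≢q = contradiction refl p≢q
p⊆q∧p≢q⇒∣p∣<∣q∣ {p = outside ∷ p} {outside ∷ q} p⊆q p≢q =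
  p⊆q∧p≢q⇒∣p∣<∣q∣ (drop-∷-⊆ p⊆q) (p≢q ∘ cong (outside ∷_))
p⊆q∧p≢q⇒∣p∣<∣q∣ {p = inside ∷ p} {inside ∷ q} p⊆q p≢q =
  s≤s (p⊆q∧p≢q⇒∣p∣<∣q∣ (drop-∷-⊆ p⊆q) (p≢q ∘ cong (inside ∷_)))
p⊆q∧p≢q⇒∣p∣<∣q∣ {p = outside ∷ p} {inside ∷ q} p⊆q _ = s≤s (p⊆q⇒∣p∣≤∣q∣ (drop-∷-⊆ p⊆q))
p⊆q∧p≢q⇒∣p∣<∣q∣ {p = inside ∷ p} {outside ∷ q} p⊆q _ with () ← p⊆q here

does-∈?≡lookup : ∀ (x : Fin n) (p : Subset n) → does (x ∈? p) ≡ lookup p x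
does-∈?≡lookup zero    (inside  ∷ p) = refl
does-∈?≡lookup zero    (outside ∷ p) = refl
does-∈?≡lookup (suc x) (_       ∷ p) = does-∈?≡lookup x p

length-filter≡sum : ∀ {A : Set} {P : Pred A 0ℓ} (P? : Decidable P) xs →
                    length (filter P? xs) ≡ sum (map (λ x → if does (P? x) then 1 else 0) xs)
length-filter≡sum P? []       = refl
length-filter≡sum P? (x ∷ xs) with does (P? x)
... | true  = cong suc (length-filter≡sum P? xs)
... | false = length-filter≡sum P? xs

-- Submodular functions

Modular : (Subset n → ℕ) → Set
Modular {n} f = ∀ (X Y : Subset n) → f (X ∪ Y) + f (X ∩ Y) ≡ f X + f Y

modular+submodular : ∀ {f g : Subset n → ℕ} → Modular f → Submodular g → Submodular (λ X → f X + g X)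
modular+submodular {f = f} {g} f-mod g-sub X Y = begin
  f (X ∪ Y) + g (X ∪ Y) + (f (X ∩ Y) + g (X ∩ Y)) ≡⟨ interchange (f (X ∪ Y)) _ _ _ ⟩
  f (X ∪ Y) + f (X ∩ Y) + (g (X ∪ Y) + g (X ∩ Y)) ≤⟨ +-mono-≤ (≤-reflexive (f-mod X Y)) (g-sub X Y) ⟩
  f X + f Y + (g X + g Y)                         ≡⟨ interchange (f X) _ _ _ ⟩
  f X + g X + (f Y + g Y)                         ∎
  where
  open ≤-Reasoning
  open CommutativeSemigroupProperties +-commutativeSemigroup using (interchange)

if∈-modular : ∀ (x : Fin n) (a b : ℕ) → Modular (λ X → if lookup X x then a else b)
if∈-modular x a b X Y rewrite lookup-zipWith _∨_ x X Y | lookup-zipWith _∧_ x X Y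
  with lookup X x | lookup Y x
... | true  | true  = refl
... | true  | false = refl
... | false | true  = +-comm a b
... | false | false = refl

submodular-∘-∩ : ∀ (Λ : Subset n) {g : Subset n → ℕ} → Submodular g → Submodular (λ X → g (X ∩ Λ))
submodular-∘-∩ Λ {g} g-sub X Y =
  subst (_≤ g (X ∩ Λ) + g (Y ∩ Λ))
    (cong₂ (λ U I → g U + g I) (sym (∩-distribʳ-∪ Λ X Y)) (sym ∩-interchange))
    (g-sub (X ∩ Λ) (Y ∩ Λ))
  where
  open CommutativeSemigroupProperties (CommutativeMonoid.commutativeSemigroup (∩-commutativeMonoid _))
    using (interchange)
  ∩-interchange : (X ∩ Y) ∩ Λ ≡ (X ∩ Λ) ∩ (Y ∩ Λ)
  ∩-interchange = trans (cong ((X ∩ Y) ∩_) (sym (∩-idem Λ))) (interchange X Y Λ Λ)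

⊓-submodular : ∀ {u i a b} k → u + i ≡ a + b → i ≤ a → i ≤ b → u ⊓ k + i ⊓ k ≤ a ⊓ k + b ⊓ k
⊓-submodular {u} {i} {a} {b} k u+i≡a+b i≤a i≤b with ≤-total a k | ≤-total b k
... | inj₁ a≤k | inj₁ b≤k rewrite m≤n⇒m⊓n≡m a≤k | m≤n⇒m⊓n≡m b≤k =
  ≤-trans (+-mono-≤ (m⊓n≤m u k) (m⊓n≤m i k)) (≤-reflexive u+i≡a+b)
... | inj₂ k≤a | _ rewrite m≥n⇒m⊓n≡n k≤a = +-mono-≤ (m⊓n≤n u k) (⊓-monoˡ-≤ k i≤b)
... | inj₁ _ | inj₂ k≤b rewrite m≥n⇒m⊓n≡n k≤b =
  subst (_≤ a ⊓ k + k) (+-comm (i ⊓ k) (u ⊓ k)) (+-mono-≤ (⊓-monoˡ-≤ k i≤a) (m⊓n≤n u k))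

-- With i < k < u, the equation u + i ≡ k + b forces b > i, which pays for the lost unit.
⊓-exchange : ∀ {u i b} k → u + i ≡ k + b → i < k → k < u → u ⊓ k + i ⊓ k ≤ k ∸ 1 + b ⊓ k
⊓-exchange {u} {i} {b} (suc k) u+i≡k+b i<k k<u
  rewrite m≥n⇒m⊓n≡n (<⇒≤ k<u) | m≤n⇒m⊓n≡m (<⇒≤ i<k) =
  subst (_≤ k + b ⊓ suc k) (+-suc k i) (+-monoʳ-≤ k (⊓-glb i<b i<k))
  where
  i<b : i < b
  i<b = +-cancelˡ-≤ (suc k) (suc i) b (subst₂ _≤_ (sym (+-suc (suc k) i)) u+i≡k+b (+-monoˡ-≤ i k<u))

uniformRank : ℕ → Subset n → ℕ
uniformRank k W = ∣ W ∣ ⊓ k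

uniformRank-submodular : ∀ k → Submodular (uniformRank {n} k)
uniformRank-submodular k X Y =
  ⊓-submodular k (∣p∪q∣+∣p∩q∣≡∣p∣+∣q∣ X Y) (∣p∩q∣≤∣p∣ X Y) (∣p∩q∣≤∣q∣ X Y)

infix 4 _≟ₛ_
_≟ₛ_ : (X Y : Subset n) → Dec (X ≡ Y)
_≟ₛ_ = ≡-dec Bool._≟_

relaxedRank : ℕ → Subset n → Subset n → ℕ
relaxedRank k T W = if does (W ≟ₛ T) then k ∸ 1 else uniformRank k W

module _ (k : ℕ) (T : Subset n) where

  private
    r = relaxedRank k T

  relaxedRank-≡ : r T ≡ k ∸ 1
  relaxedRank-≡ with T ≟ₛ T
  ... | yes _ = refl
  ... | no T≢T = contradiction refl T≢T

  relaxedRank-≢ : ∀ {W} → W ≢ T → r W ≡ uniformRank k W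
  relaxedRank-≢ {W} W≢T with W ≟ₛ T
  ... | yes W≡T = contradiction W≡T W≢T
  ... | no _ = refl

  k∸1≤relaxedRank : ∀ {W} → k ≤ ∣ W ∣ → k ∸ 1 ≤ r W
  k∸1≤relaxedRank {W} k≤∣W∣ with W ≟ₛ T
  ... | yes _ = ≤-refl
  ... | no _ = subst (k ∸ 1 ≤_) (sym (m≥n⇒m⊓n≡n k≤∣W∣)) (m∸n≤m k 1)

  module _ (∣T∣≡k : ∣ T ∣ ≡ k) where

    relaxedRank≤uniformRank : ∀ W → r W ≤ uniformRank k W
    relaxedRank≤uniformRank W with W ≟ₛ T
    ... | yes refl rewrite ∣T∣≡k | ⊓-idem k = m∸n≤m k 1
    ... | no _ = ≤-refl

    private
      ∣T∪Y∣≡∣Y∣ : ∀ Y → T ∩ Y ≡ T → ∣ T ∪ Y ∣ ≡ ∣ Y ∣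
      ∣T∪Y∣≡∣Y∣ Y I≡T = +-cancelʳ-≡ (∣ T ∣) (∣ T ∪ Y ∣) (∣ Y ∣) (begin
        ∣ T ∪ Y ∣ + ∣ T ∣      ≡⟨ cong (λ I → ∣ T ∪ Y ∣ + ∣ I ∣) I≡T ⟨
        ∣ T ∪ Y ∣ + ∣ T ∩ Y ∣  ≡⟨ ∣p∪q∣+∣p∩q∣≡∣p∣+∣q∣ T Y ⟩
        ∣ T ∣ + ∣ Y ∣          ≡⟨ +-comm (∣ T ∣) (∣ Y ∣) ⟩
        ∣ Y ∣ + ∣ T ∣          ∎)
        where open ≡-Reasoning

      submodular-at-T : ∀ Y → Y ≢ T → r (T ∪ Y) + r (T ∩ Y) ≤ r T + r Y
      submodular-at-T Y Y≢T = by-cases (T ∪ Y ≟ₛ T) (T ∩ Y ≟ₛ T)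
        where
        by-cases : Dec (T ∪ Y ≡ T) → Dec (T ∩ Y ≡ T) → r (T ∪ Y) + r (T ∩ Y) ≤ r T + r Y
        by-cases (yes U≡T) _ = begin
          r (T ∪ Y) + r (T ∩ Y)         ≡⟨ cong (λ U → r U + r (T ∩ Y)) U≡T ⟩
          r T + r (T ∩ Y)               ≤⟨ +-monoʳ-≤ (r T) (relaxedRank≤uniformRank (T ∩ Y)) ⟩
          r T + uniformRank k (T ∩ Y)   ≤⟨ +-monoʳ-≤ (r T) (⊓-monoˡ-≤ k (∣p∩q∣≤∣q∣ T Y)) ⟩
          r T + uniformRank k Y         ≡⟨ cong (r T +_) (relaxedRank-≢ Y≢T) ⟨
          r T + r Y                     ∎
          where open ≤-Reasoning
        by-cases (no U≢T) (yes I≡T) = ≤-reflexive (begin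
          r (T ∪ Y) + r (T ∩ Y)         ≡⟨ cong₂ _+_ (relaxedRank-≢ U≢T) (cong r I≡T) ⟩
          uniformRank k (T ∪ Y) + r T   ≡⟨ cong (λ m → m ⊓ k + r T) (∣T∪Y∣≡∣Y∣ Y I≡T) ⟩
          uniformRank k Y + r T         ≡⟨ cong (_+ r T) (relaxedRank-≢ Y≢T) ⟨
          r Y + r T                     ≡⟨ +-comm (r Y) (r T) ⟩
          r T + r Y                     ∎)
          where open ≡-Reasoning
        by-cases (no U≢T) (no I≢T) = begin
          r (T ∪ Y) + r (T ∩ Y)                         ≡⟨ cong₂ _+_ (relaxedRank-≢ U≢T) (relaxedRank-≢ I≢T) ⟩
          uniformRank k (T ∪ Y) + uniformRank k (T ∩ Y) ≤⟨ ⊓-exchange k modular ∣I∣<k k<∣U∣ ⟩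
          k ∸ 1 + uniformRank k Y                       ≡⟨ cong₂ _+_ relaxedRank-≡ (relaxedRank-≢ Y≢T) ⟨
          r T + r Y                                     ∎
          where
          open ≤-Reasoning
          modular : ∣ T ∪ Y ∣ + ∣ T ∩ Y ∣ ≡ k + ∣ Y ∣
          modular = trans (∣p∪q∣+∣p∩q∣≡∣p∣+∣q∣ T Y) (cong (_+ ∣ Y ∣) ∣T∣≡k)
          ∣I∣<k : ∣ T ∩ Y ∣ < k
          ∣I∣<k = subst (∣ T ∩ Y ∣ <_) ∣T∣≡k (p⊆q∧p≢q⇒∣p∣<∣q∣ (p∩q⊆p T Y) I≢T)
          k<∣U∣ : k < ∣ T ∪ Y ∣
          k<∣U∣ = subst (_< ∣ T ∪ Y ∣) ∣T∣≡k (p⊆q∧p≢q⇒∣p∣<∣q∣ (p⊆p∪q Y) (U≢T ∘ sym))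

    relaxedRank-submodular : Submodular r
    relaxedRank-submodular X Y = by-cases X Y (X ≟ₛ T) (Y ≟ₛ T)
      where
      by-cases : ∀ X Y → Dec (X ≡ T) → Dec (Y ≡ T) → r (X ∪ Y) + r (X ∩ Y) ≤ r X + r Y
      by-cases _ _ (yes refl) (yes refl) = ≤-reflexive (cong₂ (λ U I → r U + r I) (∪-idem T) (∩-idem T))
      by-cases _ Y (yes refl) (no Y≢T) = submodular-at-T Y Y≢T
      by-cases X _ (no X≢T) (yes refl) =
        subst₂ _≤_ (cong₂ (λ U I → r U + r I) (∪-comm T X) (∩-comm T X)) (+-comm (r T) (r X))
          (submodular-at-T X X≢T)
      by-cases X Y (no X≢T) (no Y≢T) = begin
        r (X ∪ Y) + r (X ∩ Y)                         ≤⟨ +-mono-≤ (relaxedRank≤uniformRank (X ∪ Y))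
                                                                  (relaxedRank≤uniformRank (X ∩ Y)) ⟩
        uniformRank k (X ∪ Y) + uniformRank k (X ∩ Y) ≤⟨ uniformRank-submodular k X Y ⟩
        uniformRank k X + uniformRank k Y             ≡⟨ cong₂ _+_ (relaxedRank-≢ X≢T) (relaxedRank-≢ Y≢T) ⟨
        r X + r Y                                     ∎
        where open ≤-Reasoning

-- Potentials along paths and cycles

last-∈ : ∀ {A : Set} (u v : A) vs → last u (v ∷ vs) ∈ v ∷ vs
last-∈ u v []       = here refl
last-∈ u v (w ∷ vs) = there (last-∈ v w vs)

last-∷ʳ : ∀ {A : Set} (u : A) vs w → last u (vs ++ [ w ]) ≡ w
last-∷ʳ u []       w = refl
last-∷ʳ u (v ∷ vs) w = last-∷ʳ v vs w

module _ (G : Graph n) where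

  ClosedWalk : List (Fin n) → Set
  ClosedWalk vs = Path G vs × Closes G vs

  path-∷ʳ : ∀ u vs w → Path G (u ∷ vs) → Adj G (last u vs) w → Path G (u ∷ vs ++ [ w ])
  path-∷ʳ u []       w _            u~w = u~w , _
  path-∷ʳ u (v ∷ vs) w (u~v , path) z~w = u~v , path-∷ʳ v vs w path z~w

  rotate-once : ∀ u vs → ClosedWalk (u ∷ vs) → ClosedWalk (vs ++ [ u ])
  rotate-once u []       walk                  = walk
  rotate-once u (v ∷ vs) ((u~v , path) , z~u) =
    path-∷ʳ v vs u path z~u , subst (λ z → Adj G z v) (sym (last-∷ʳ v vs u)) u~v

  rotate : ∀ as x bs → ClosedWalk (as ++ x ∷ bs) → ClosedWalk (x ∷ bs ++ as)
  rotate []       x bs walk = subst (ClosedWalk ∘ (x ∷_)) (sym (++-identityʳ bs)) walk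
  rotate (a ∷ as) x bs walk =
    subst (ClosedWalk ∘ (x ∷_)) (++-assoc bs [ a ] as)
      (rotate as x (bs ++ [ a ]) (subst ClosedWalk (++-assoc as (x ∷ bs) [ a ]) (rotate-once a _ walk)))

module PathPotential (G : Graph n) (w φ : Fin n → ℕ) (x : Fin n)
       (step : ∀ {u v} → Adj G u v → u ≢ x → v ≢ x → φ v ≤ φ u + w u + w v) where

  weight : List (Fin n) → ℕ
  weight vs = sum (map w vs)

  private
    singleton : ∀ a b → a + b + b ≡ a + 2 * (b + 0)
    singleton = solve-∀

  potential-rise : ∀ u vs → All (_≢ x) (u ∷ vs) → Path G (u ∷ vs) →
                   φ (last u vs) + w u + w (last u vs) ≤ φ u + 2 * weight (u ∷ vs)
  potential-rise u [] _ _ = ≤-reflexive (singleton (φ u) (w u))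
  potential-rise u (v ∷ vs) (u≢x ∷ v∷vs≢x) (u~v , path) =
    +-cancelʳ-≤ (w v) _ _ (begin
      φ z + w u + w z + w v       ≡⟨ regroup (φ z) (w u) (w z) (w v) ⟩
      φ z + w v + w z + w u       ≤⟨ +-monoˡ-≤ (w u) (potential-rise v vs v∷vs≢x path) ⟩
      φ v + 2 * W + w u           ≤⟨ +-monoˡ-≤ (w u) (+-monoˡ-≤ (2 * W) (step u~v u≢x (All.head v∷vs≢x))) ⟩
      φ u + w u + w v + 2 * W + w u ≡⟨ collect (φ u) (w u) (w v) W ⟩
      φ u + 2 * (w u + W) + w v   ∎)
    where
    open ≤-Reasoning
    z = last v vs
    W = weight (v ∷ vs)
    regroup : ∀ a b c d → a + b + c + d ≡ a + d + c + b
    regroup = solve-∀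
    collect : ∀ a b c d → a + b + c + 2 * d + b ≡ a + 2 * (b + d) + c
    collect = solve-∀

  potential-fall : ∀ u vs → All (_≢ x) (u ∷ vs) → Path G (u ∷ vs) →
                   φ u + w u + w (last u vs) ≤ φ (last u vs) + 2 * weight (u ∷ vs)
  potential-fall u [] _ _ = ≤-reflexive (singleton (φ u) (w u))
  potential-fall u (v ∷ vs) (u≢x ∷ v∷vs≢x) (u~v , path) = begin
    φ u + w u + w z                 ≤⟨ +-monoˡ-≤ (w z) (+-monoˡ-≤ (w u) step′) ⟩
    φ v + w v + w u + w u + w z     ≡⟨ regroup (φ v) (w v) (w u) (w z) ⟩
    φ v + w v + w z + 2 * w u       ≤⟨ +-monoˡ-≤ (2 * w u) (potential-fall v vs v∷vs≢x path) ⟩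
    φ z + 2 * W + 2 * w u           ≡⟨ collect (φ z) W (w u) ⟩
    φ z + 2 * (w u + W)             ∎
    where
    open ≤-Reasoning
    z = last v vs
    W = weight (v ∷ vs)
    step′ = step (Adj-sym G u~v) (All.head v∷vs≢x) u≢x
    regroup : ∀ a b c d → a + b + c + c + d ≡ a + b + d + 2 * c
    regroup = solve-∀
    collect : ∀ a b c → a + 2 * b + 2 * c ≡ a + 2 * (c + b)
    collect = solve-∀

  -- If x has only the neighbours a and b, every cycle through x contains a path
  -- from a to b avoiding x, so its weight is at least half of |φ b − φ a|.
  module TwoNeighbours {a b : Fin n} {K : ℕ} (neighbours : ∀ {v} → Adj G x v → v ≡ a ⊎ v ≡ b)
         (w[a]≡0 : w a ≡ 0) (w[b]≡0 : w b ≡ 0) (φ[a]≡0 : φ a ≡ 0) (φ[b]≡2K : φ b ≡ 2 * K) where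

    private
      bound : ∀ {W} → φ b ≤ φ a + 2 * W → K ≤ W
      bound {W} φb≤ = *-cancelˡ-≤ 2 (subst₂ _≤_ φ[b]≡2K (cong (_+ 2 * W) φ[a]≡0) φb≤)

      drop-weights : ∀ {s c d t} → s + c + d ≤ t → s ≤ t
      drop-weights {s} {c = c} {d} = ≤-trans (≤-trans (m≤m+n s c) (m≤m+n (s + c) d))

    around-x : ∀ ws → Unique (x ∷ ws) → ClosedWalk G (x ∷ ws) → 2 ≤ length ws → K ≤ weight ws
    around-x (v ∷ v′ ∷ vs) (x∉ ∷ v∉ ∷ _) ((x~v , path) , z~x) _
      with neighbours x~v | neighbours (Adj-sym G z~x)
    ... | inj₁ refl | inj₁ z≡a = contradiction (sym z≡a) (All.lookup v∉ (last-∈ v v′ vs))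
    ... | inj₂ refl | inj₂ z≡b = contradiction (sym z≡b) (All.lookup v∉ (last-∈ v v′ vs))
    ... | inj₁ refl | inj₂ z≡b =
      bound (drop-weights (subst (λ z → φ z + w a + w z ≤ φ a + 2 * weight (a ∷ v′ ∷ vs)) z≡b
                                 (potential-rise a (v′ ∷ vs) (All.map (_∘ sym) x∉) path)))
    ... | inj₂ refl | inj₁ z≡a =
      bound (drop-weights (subst (λ z → φ b + w b + w z ≤ φ z + 2 * weight (b ∷ v′ ∷ vs)) z≡a
                                 (potential-fall b (v′ ∷ vs) (All.map (_∘ sym) x∉) path)))
    around-x (_ ∷ []) _ _ (s≤s ())

    cycle-through-x-weight : ∀ vs → IsCycle G vs → x ∈ vs → K ≤ weight vs
    cycle-through-x-weight vs (3≤∣vs∣ , unique , walk) x∈vs with as , bs , refl ← ∈-∃++ x∈vs = begin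
      K                     ≤⟨ around-x (bs ++ as) (Unique-resp-↭ (↭⇒↭ₛ σ) unique) (rotate G as x bs walk) 2≤ ⟩
      weight (bs ++ as)     ≤⟨ m≤n+m _ (w x) ⟩
      weight (x ∷ bs ++ as) ≡⟨ sum-↭ (map⁺ w σ) ⟨
      weight (as ++ x ∷ bs) ∎
      where
      open ≤-Reasoning
      open PermutationSetoid (setoid (Fin n)) using (Unique-resp-↭)
      σ : as ++ x ∷ bs ↭ x ∷ bs ++ as
      σ = ++-comm as (x ∷ bs)
      2≤ : 2 ≤ length (bs ++ as)
      2≤ = s≤s⁻¹ (subst (3 ≤_) (↭-length σ) 3≤∣vs∣)

-- Value-oracle algorithms

queried : Alg n → (Subset n → ℕ) → List (Subset n)
queried (answer _)  f = []
queried (query X k) f = X ∷ queried (k (f X)) f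

length-queried : ∀ (A : Alg n) f → length (queried A f) ≡ queries A f
length-queried (answer _)  f = refl
length-queried (query X k) f = cong suc (length-queried (k (f X)) f)

run-cong : ∀ (A : Alg n) {f g} → (∀ {X} → X ∈ queried A f → g X ≡ f X) → run A g ≡ run A f
run-cong (answer _)  _ = refl
run-cong (query X k) {f} agree rewrite agree (here refl) = run-cong (k (f X)) (agree ∘ there)

module _ {B : Set} (_≟_ : DecidableEquality B) where

  open DecMembership _≟_ using () renaming (_∈?_ to _∈ᴸ?_)

  missed-key : ∀ {m} (key : Fin m → B) → Injective _≡_ _≡_ key →
               (ys : List B) → length ys < m → ∃ λ t → ¬ key t ∈ ys
  missed-key {m} key key-injective ys ∣ys∣<m with all? (λ t → key t ∈ᴸ? ys)
  ... | no ¬all = ¬∀⟶∃¬ m _ (λ t → key t ∈ᴸ? ys) ¬all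
  ... | yes all = contradiction (injective⇒≤ position-injective) (<⇒≱ ∣ys∣<m)
    where
    position-injective : Injective _≡_ _≡_ (λ t → index (all t))
    position-injective same = key-injective (MembershipSetoid.index-injective (setoid B) (all _) (all _) same)

  adversary-bound : (view : Subset n → B) → ∀ {m} (key : Fin m → B) → Injective _≡_ _≡_ key →
                    (A : Alg n) (f₀ : Subset n → ℕ) (f : Fin m → Subset n → ℕ) →
                    (∀ t {X} → view X ≢ key t → f t X ≡ f₀ X) →
                    (∀ t → run A (f t) ≢ run A f₀) →
                    m ≤ queries A f₀
  adversary-bound view {m} key key-injective A f₀ f agree distinguished = ≮⇒≥ λ queries<m →
    let t , key-missed = missed-key key key-injective (map view (queried A f₀)) (∣views∣<m queries<m)
    in distinguished t (run-cong A λ X∈ → agree t λ view≡key →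
         key-missed (subst (_∈ map view (queried A f₀)) view≡key (∈-map⁺ view X∈)))
    where
    ∣views∣<m : queries A f₀ < m → length (map view (queried A f₀)) < m
    ∣views∣<m = subst (_< m) (sym (trans (length-map view (queried A f₀)) (length-queried A f₀)))

funToFin-cong : ∀ {m n} {f g : Fin m → Fin n} → (∀ i → f i ≡ g i) → funToFin f ≡ funToFin g
funToFin-cong {zero}  _   = refl
funToFin-cong {suc m} f≗g = cong₂ combine (f≗g zero) (funToFin-cong (f≗g ∘ suc))

finToFun-injective : ∀ {m n} {s t : Fin (n ^ m)} → (∀ i → finToFun {n} {m} s i ≡ finToFun t i) → s ≡ t
finToFun-injective {m} {n} {s} {t} s≗t = begin
  s                              ≡⟨ funToFin-finToFin {m} {n} s ⟨
  funToFin (finToFun {n} {m} s)  ≡⟨ funToFin-cong s≗t ⟩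
  funToFin (finToFun {n} {m} t)  ≡⟨ funToFin-finToFin {m} {n} t ⟩
  t                              ∎
  where open ≡-Reasoning

-- The necklace graph

module Necklace (p k : ℕ) where

  N : ℕ
  N = k * p + k + 2

  d : ℕ
  d = suc p

  hub : ℕ → ℕ
  hub i = i * d

  bead : ℕ → ℕ → ℕ
  bead i j = suc j + i * d

  apex : ℕ
  apex = suc (hub k)

  apex<N : apex < N
  apex<N = ≤-reflexive (layout k p)
    where
    layout : ∀ k p → suc (suc (k * suc p)) ≡ k * p + k + 2
    layout = solve-∀

  data Edge : ℕ → ℕ → Set where
    hub-bead   : ∀ {i j} → i < k → j < p → Edge (hub i) (bead i j)
    bead-hub   : ∀ {i j} → i < k → j < p → Edge (bead i j) (hub (suc i))
    first-apex : Edge (hub 0) apex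
    last-apex  : Edge (hub k) apex

  hub<bead : ∀ i j → hub i < bead i j
  hub<bead i j = s≤s (m≤n+m (hub i) j)

  bead<hub : ∀ i {j} → j < p → bead i j < hub (suc i)
  bead<hub i j<p = +-monoˡ-< (hub i) (s≤s j<p)

  hub≤hub : ∀ {i i′} → i ≤ i′ → hub i ≤ hub i′
  hub≤hub = *-monoˡ-≤ d

  hub<apex : ∀ {i} → i ≤ k → hub i < apex
  hub<apex i≤k = s≤s (hub≤hub i≤k)

  bead<apex : ∀ {i j} → i < k → j < p → bead i j < apex
  bead<apex {i} i<k j<p = <-trans (<-≤-trans (bead<hub i j<p) (hub≤hub i<k)) ≤-refl

  Edge⇒< : ∀ {a b} → Edge a b → a < b
  Edge⇒< (hub-bead {i} {j} _ _) = hub<bead i j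
  Edge⇒< (bead-hub {i} _ j<p)   = bead<hub i j<p
  Edge⇒< first-apex             = hub<apex z≤n
  Edge⇒< last-apex              = ≤-refl

  Edge⇒≤apex : ∀ {a b} → Edge a b → b ≤ apex
  Edge⇒≤apex (hub-bead i<k j<p) = <⇒≤ (bead<apex i<k j<p)
  Edge⇒≤apex (bead-hub i<k _)   = <⇒≤ (hub<apex i<k)
  Edge⇒≤apex first-apex         = ≤-refl
  Edge⇒≤apex last-apex          = ≤-refl

  Edge-into-apex : ∀ {a b} → Edge a b → b ≡ apex → a ≡ hub 0 ⊎ a ≡ hub k
  Edge-into-apex (hub-bead i<k j<p) b≡apex = contradiction b≡apex (<⇒≢ (bead<apex i<k j<p))
  Edge-into-apex (bead-hub i<k _)   b≡apex = contradiction b≡apex (<⇒≢ (hub<apex i<k))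
  Edge-into-apex first-apex         _      = inj₁ refl
  Edge-into-apex last-apex          _      = inj₂ refl

  -- Codes ≥ N never occur; the junk value keeps vertex total.
  vertex : ℕ → Fin N
  vertex m with m <? N
  ... | yes m<N = fromℕ< m<N
  ... | no _    = fromℕ< apex<N

  toℕ-vertex : ∀ {m} → m < N → toℕ (vertex m) ≡ m
  toℕ-vertex {m} m<N with m <? N
  ... | yes m<N′ = toℕ-fromℕ< m<N′
  ... | no m≮N   = contradiction m<N m≮N

  vertex-toℕ : ∀ v → vertex (toℕ v) ≡ v
  vertex-toℕ v = toℕ-injective (toℕ-vertex (toℕ<n v))

  vertex-injective : ∀ {a b} → a < N → b < N → vertex a ≡ vertex b → a ≡ b
  vertex-injective a<N b<N same =
    trans (sym (toℕ-vertex a<N)) (trans (cong toℕ same) (toℕ-vertex b<N))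

  necklace : Graph N
  necklace = record
    { Adj     = λ u v → Edge (toℕ u) (toℕ v) ⊎ Edge (toℕ v) (toℕ u)
    ; Adj-sym = λ { (inj₁ e) → inj₂ e ; (inj₂ e) → inj₁ e }
    ; Adj-irr = λ { (inj₁ e) → <-irrefl refl (Edge⇒< e) ; (inj₂ e) → <-irrefl refl (Edge⇒< e) }
    }

  adjacent : ∀ {a b} → Edge a b → Adj necklace (vertex a) (vertex b)
  adjacent {a} {b} e = inj₁ (subst₂ Edge (sym (toℕ-vertex a<N)) (sym (toℕ-vertex b<N)) e)
    where
    b<N = ≤-<-trans (Edge⇒≤apex e) apex<N
    a<N = <-trans (Edge⇒< e) b<N

  apexV : Fin N
  apexV = vertex apex

  apex-neighbours : ∀ {v} → Adj necklace apexV v → v ≡ vertex (hub 0) ⊎ v ≡ vertex (hub k)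
  apex-neighbours {v} (inj₁ e) =
    contradiction (Edge⇒≤apex e) (<⇒≱ (subst (_< toℕ v) (toℕ-vertex apex<N) (Edge⇒< e)))
  apex-neighbours {v} (inj₂ e) with Edge-into-apex e (toℕ-vertex apex<N)
  ... | inj₁ v≡hub₀ = inj₁ (trans (sym (vertex-toℕ v)) (cong vertex v≡hub₀))
  ... | inj₂ v≡hubₖ = inj₂ (trans (sym (vertex-toℕ v)) (cong vertex v≡hubₖ))

  -- The beads j < p of level i < k are the codes m with m mod d ≠ 0 and m < hub k.
  isBead : ℕ → Bool
  isBead m = not (m % d ≡ᵇ 0) ∧ (m <ᵇ hub k)

  level : ℕ → ℕ
  level m = 2 * (m / d) + (if m % d ≡ᵇ 0 then 0 else 1)

  bead%d : ∀ i {j} → j < p → bead i j % d ≡ suc j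
  bead%d i j<p = trans ([m+kn]%n≡m%n (suc _) i d) (m<n⇒m%n≡m (s≤s j<p))

  bead/d : ∀ i {j} → j < p → bead i j / d ≡ i
  bead/d i j<p = trans (+-distrib-/-∣ʳ (suc _) (divides-refl i))
                       (cong₂ _+_ (m<n⇒m/n≡0 (s≤s j<p)) (m*n/n≡m i d))

  bead-injective : ∀ {i i′ j j′} → j < p → j′ < p → bead i j ≡ bead i′ j′ → i ≡ i′ × j ≡ j′
  bead-injective {i} {i′} j<p j′<p same =
    trans (sym (bead/d i j<p)) (trans (cong (_/ d) same) (bead/d i′ j′<p)) ,
    suc-injective (trans (sym (bead%d i j<p)) (trans (cong (_% d) same) (bead%d i′ j′<p)))

  isBead-bead : ∀ {i j} → i < k → j < p → isBead (bead i j) ≡ true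
  isBead-bead {i} {j} i<k j<p =
    trans (cong (λ r → not (r ≡ᵇ 0) ∧ (bead i j <ᵇ hub k)) (bead%d i j<p))
          (Equivalence.to T-≡ (<⇒<ᵇ (<-≤-trans (bead<hub i j<p) (hub≤hub i<k))))

  isBead-hub : ∀ i → isBead (hub i) ≡ false
  isBead-hub i = cong (λ r → not (r ≡ᵇ 0) ∧ (hub i <ᵇ hub k)) (m*n%n≡0 i d)

  isBead-apex : isBead apex ≡ false
  isBead-apex with apex <ᵇ hub k in apex<ᵇhub
  ... | true  = contradiction (<ᵇ⇒< apex (hub k) (Equivalence.from T-≡ apex<ᵇhub)) (<-asym (n<1+n (hub k)))
  ... | false = ∧-zeroʳ _

  level-hub : ∀ i → level (hub i) ≡ 2 * i
  level-hub i = trans (cong₂ (λ q r → 2 * q + (if r ≡ᵇ 0 then 0 else 1)) (m*n/n≡m i d) (m*n%n≡0 i d))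
                      (+-identityʳ (2 * i))

  level-bead : ∀ i {j} → j < p → level (bead i j) ≡ 2 * i + 1
  level-bead i j<p = cong₂ (λ q r → 2 * q + (if r ≡ᵇ 0 then 0 else 1)) (bead/d i j<p) (bead%d i j<p)

  Λ : Subset N
  Λ = tabulate (isBead ∘ toℕ)

  does-∈Λ : ∀ v → does (v ∈? Λ) ≡ isBead (toℕ v)
  does-∈Λ v = trans (does-∈?≡lookup v Λ) (lookup∘tabulate (isBead ∘ toℕ) v)

  vertex∈Λ⇔isBead : ∀ {y} → y < N → vertex y ∈ₛ Λ ⇔ isBead y ≡ true
  vertex∈Λ⇔isBead {y} y<N = mk⇔ (λ y∈Λ → trans (sym lookup-Λ) ([]=⇒lookup y∈Λ))
                                (λ y-bead → lookup⇒[]= (vertex y) Λ (trans lookup-Λ y-bead))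
    where
    lookup-Λ : lookup Λ (vertex y) ≡ isBead y
    lookup-Λ = trans (lookup∘tabulate (isBead ∘ toℕ) (vertex y)) (cong isBead (toℕ-vertex y<N))

  codeWeight : ℕ → ℕ
  codeWeight m = if isBead m then 1 else 0

  beadWeight : Fin N → ℕ
  beadWeight v = codeWeight (toℕ v)

  potential : Fin N → ℕ
  potential v = level (toℕ v)

  edge-step : ∀ {a b} → Edge a b → b ≢ apex →
              level b ≤ level a + codeWeight a + codeWeight b ×
              level a ≤ level b + codeWeight b + codeWeight a
  edge-step (hub-bead {i} i<k j<p) _
    rewrite level-hub i | level-bead i j<p | isBead-hub i | isBead-bead i<k j<p =
    ≤-reflexive (up i) , ≤-trans (m≤m+n (2 * i) 2) (≤-reflexive (down i))
    where
    up : ∀ i → 2 * i + 1 ≡ 2 * i + 0 + 1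
    up = solve-∀
    down : ∀ i → 2 * i + 2 ≡ 2 * i + 1 + 1 + 0
    down = solve-∀
  edge-step (bead-hub {i} i<k j<p) _
    rewrite level-hub (suc i) | level-bead i j<p | isBead-hub (suc i) | isBead-bead i<k j<p =
    ≤-reflexive (up i) , ≤-trans (m≤m+n (2 * i + 1) 2) (≤-reflexive (down i))
    where
    up : ∀ i → 2 * suc i ≡ 2 * i + 1 + 1 + 0
    up = solve-∀
    down : ∀ i → 2 * i + 1 + 2 ≡ 2 * suc i + 0 + 1
    down = solve-∀
  edge-step first-apex b≢apex = contradiction refl b≢apex
  edge-step last-apex  b≢apex = contradiction refl b≢apex

  private
    toℕ≢apex : ∀ {v} → v ≢ apexV → toℕ v ≢ apex
    toℕ≢apex {v} v≢apex v≡apex = v≢apex (trans (sym (vertex-toℕ v)) (cong vertex v≡apex))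

  potential-step : ∀ {u v} → Adj necklace u v → u ≢ apexV → v ≢ apexV →
                   potential v ≤ potential u + beadWeight u + beadWeight v
  potential-step (inj₁ e) _       v≢apex = proj₁ (edge-step e (toℕ≢apex v≢apex))
  potential-step (inj₂ e) u≢apex _       = proj₂ (edge-step e (toℕ≢apex u≢apex))

  open PathPotential necklace beadWeight potential apexV potential-step

  hub<N : ∀ {i} → i ≤ k → hub i < N
  hub<N i≤k = <-trans (hub<apex i≤k) apex<N

  weight-hub : ∀ {i} → i ≤ k → beadWeight (vertex (hub i)) ≡ 0
  weight-hub {i} i≤k =
    trans (cong codeWeight (toℕ-vertex (hub<N i≤k))) (cong (λ b → if b then 1 else 0) (isBead-hub i))

  potential-hub : ∀ {i} → i ≤ k → potential (vertex (hub i)) ≡ 2 * i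
  potential-hub {i} i≤k = trans (cong level (toℕ-vertex (hub<N i≤k))) (level-hub i)

  open TwoNeighbours {K = k} apex-neighbours
         (weight-hub z≤n) (weight-hub ≤-refl) (potential-hub z≤n) (potential-hub ≤-refl)

  length-beads≡weight : ∀ vs → length (filter (_∈? Λ) vs) ≡ weight vs
  length-beads≡weight vs = trans (length-filter≡sum (_∈? Λ) vs)
    (cong sum (map-cong (λ v → cong (λ b → if b then 1 else 0) (does-∈Λ v)) vs))

  apex-cycle-beads : ∀ {S} → IsCycleVertexSet necklace S → apexV ∈ₛ S → k ≤ ∣ S ∩ Λ ∣
  apex-cycle-beads {S} (vs , cycle@(_ , unique , _) , S⇔vs) apex∈S = begin
    k                          ≤⟨ cycle-through-x-weight vs cycle (Equivalence.to (S⇔vs apexV) apex∈S) ⟩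
    weight vs                  ≡⟨ length-beads≡weight vs ⟨
    length (filter (_∈? Λ) vs) ≤⟨ unique⇒length≤∣p∣ (Unique.filter⁺ (_∈? Λ) unique)
                                                    (All.tabulate in-S∩Λ) ⟩
    ∣ S ∩ Λ ∣                  ∎
    where
    open ≤-Reasoning
    in-S∩Λ : ∀ {v} → v ∈ filter (_∈? Λ) vs → v ∈ₛ S ∩ Λ
    in-S∩Λ {v} v∈ with v∈vs , v∈Λ ← ∈-filter⁻ (_∈? Λ) v∈ = x∈p∩q⁺ (Equivalence.from (S⇔vs v) v∈vs , v∈Λ)

  ascent : ℕ → (m : ℕ) → (Fin m → Fin p) → List ℕ
  ascent i zero    T = apex ∷ []
  ascent i (suc m) T = bead i (toℕ (T zero)) ∷ hub (suc i) ∷ ascent (suc i) m (T ∘ suc)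

  private
    next-offset : ∀ {i m} → i + suc m ≡ k → suc i + m ≡ k
    next-offset {i} {m} i+1+m≡k = trans (sym (+-suc i m)) i+1+m≡k

    offset<k : ∀ {i m} → i + suc m ≡ k → i < k
    offset<k {i} {m} i+1+m≡k = ≤-trans (s≤s (m≤m+n i m)) (≤-reflexive (next-offset i+1+m≡k))

    offset≤k : ∀ {i m} → i + m ≡ k → i ≤ k
    offset≤k {i} {m} i+m≡k = ≤-trans (m≤m+n i m) (≤-reflexive i+m≡k)

    hub<hub : ∀ i → hub i < hub (suc i)
    hub<hub i = m<n+m (hub i) z<s

  ascent≤apex : ∀ i m T → i + m ≡ k → ∀ {y} → y ∈ ascent i m T → y ≤ apex
  ascent≤apex i zero    T _ (here refl) = ≤-refl
  ascent≤apex i (suc m) T i+m≡k (here refl) = <⇒≤ (bead<apex (offset<k i+m≡k) (toℕ<n (T zero)))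
  ascent≤apex i (suc m) T i+m≡k (there (here refl)) = <⇒≤ (hub<apex (offset<k i+m≡k))
  ascent≤apex i (suc m) T i+m≡k (there (there y∈)) = ascent≤apex (suc i) m (T ∘ suc) (next-offset i+m≡k) y∈

  ascent-increasing : ∀ i m T → i + m ≡ k → AllPairs _<_ (hub i ∷ ascent i m T)
  ascent-increasing i zero T i+m≡k = (hub<apex {i} (offset≤k {m = 0} i+m≡k) ∷ []) ∷ [] ∷ []
  ascent-increasing i (suc m) T i+m≡k
    with hub′<rest ∷ rest ← ascent-increasing (suc i) m (T ∘ suc) (next-offset i+m≡k) =
    (hub<bead i j ∷ hub<hub i ∷ All.map (<-trans (hub<hub i)) hub′<rest) ∷
    (bead<hub′ ∷ All.map (<-trans bead<hub′) hub′<rest) ∷ hub′<rest ∷ rest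
    where
    j = toℕ (T zero)
    bead<hub′ = bead<hub i (toℕ<n (T zero))

  ascent-path : ∀ i m T → i + m ≡ k → Path necklace (map vertex (hub i ∷ ascent i m T))
  ascent-path i zero T i+m≡k =
    adjacent (subst (λ i′ → Edge (hub i′) apex) (sym (trans (sym (+-identityʳ i)) i+m≡k)) last-apex) , _
  ascent-path i (suc m) T i+m≡k =
    adjacent (hub-bead (offset<k i+m≡k) (toℕ<n (T zero))) ,
    adjacent (bead-hub (offset<k i+m≡k) (toℕ<n (T zero))) ,
    ascent-path (suc i) m (T ∘ suc) (next-offset i+m≡k)

  last-ascent : ∀ i m T u → last u (map vertex (ascent i m T)) ≡ vertex apex
  last-ascent i zero    T u = refl
  last-ascent i (suc m) T u = last-ascent (suc i) m (T ∘ suc) (vertex (hub (suc i)))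

  apex∈ascent : ∀ i m T → apex ∈ ascent i m T
  apex∈ascent i zero    T = here refl
  apex∈ascent i (suc m) T = there (there (apex∈ascent (suc i) m (T ∘ suc)))

  bead∈ascent : ∀ i m T (l : Fin m) → bead (i + toℕ l) (toℕ (T l)) ∈ ascent i m T
  bead∈ascent i (suc m) T zero    = here (cong (λ i′ → bead i′ (toℕ (T zero))) (+-identityʳ i))
  bead∈ascent i (suc m) T (suc l) =
    there (there (subst (λ i′ → bead i′ (toℕ (T (suc l))) ∈ ascent (suc i) m (T ∘ suc)) (sym (+-suc i (toℕ l)))
                        (bead∈ascent (suc i) m (T ∘ suc) l)))

  ascent-beads : ∀ i m T {y} → y ∈ ascent i m T → isBead y ≡ true →
                 ∃ λ (l : Fin m) → y ≡ bead (i + toℕ l) (toℕ (T l))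
  ascent-beads i zero    T (here refl) apex-bead = contradiction (trans (sym isBead-apex) apex-bead) λ ()
  ascent-beads i (suc m) T (here refl) _ = zero , cong (λ i′ → bead i′ (toℕ (T zero))) (sym (+-identityʳ i))
  ascent-beads i (suc m) T (there (here refl)) hub-is-bead =
    contradiction (trans (sym (isBead-hub (suc i))) hub-is-bead) λ ()
  ascent-beads i (suc m) T (there (there y∈)) y-bead
    with l , y≡bead ← ascent-beads (suc i) m (T ∘ suc) y∈ y-bead =
    suc l , trans y≡bead (cong (λ i′ → bead i′ (toℕ (T (suc l)))) (sym (+-suc i (toℕ l))))

  increasing⇒unique : ∀ {ys} → AllPairs _<_ ys → All (_< N) ys → Unique (map vertex ys)
  increasing⇒unique [] [] = []
  increasing⇒unique {y ∷ _} (y<ys ∷ increasing) (y<N ∷ ys<N) =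
    All.map⁺ (All.zipWith (λ (y<z , z<N) → <⇒≢ y<z ∘ vertex-injective y<N z<N) (y<ys , ys<N)) ∷
    increasing⇒unique increasing ys<N

  cycleCodes : (Fin k → Fin p) → List ℕ
  cycleCodes T = hub 0 ∷ ascent 0 k T

  cycleCodes<N : ∀ T {y} → y ∈ cycleCodes T → y < N
  cycleCodes<N T (here refl) = hub<N z≤n
  cycleCodes<N T (there y∈) = ≤-<-trans (ascent≤apex 0 k T refl y∈) apex<N

  cycleCodes-beads : ∀ T {y} → y ∈ cycleCodes T → isBead y ≡ true → ∃ λ l → y ≡ bead (toℕ l) (toℕ (T l))
  cycleCodes-beads T (here refl) hub-is-bead = contradiction (trans (sym (isBead-hub 0)) hub-is-bead) λ ()
  cycleCodes-beads T (there y∈)  y-bead      = ascent-beads 0 k T y∈ y-bead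

  cycleOf : (Fin k → Fin p) → List (Fin N)
  cycleOf T = map vertex (cycleCodes T)

  cycleOf-isCycle : 1 ≤ k → ∀ T → IsCycle necklace (cycleOf T)
  cycleOf-isCycle 1≤k T = long , unique , ascent-path 0 k T refl , closing
    where
    long : 3 ≤ length (cycleOf T)
    long = subst (3 ≤_) (sym (length-map vertex (cycleCodes T))) (s≤s (two 1≤k))
      where
      two : ∀ {m} {T : Fin m → Fin p} → 1 ≤ m → 2 ≤ length (ascent 0 m T)
      two (s≤s z≤n) = s≤s (s≤s z≤n)
    unique : Unique (cycleOf T)
    unique = increasing⇒unique (ascent-increasing 0 k T refl) (All.tabulate (cycleCodes<N T))
    closing : Closes necklace (cycleOf T)
    closing = subst (λ z → Adj necklace z (vertex (hub 0))) (sym (last-ascent 0 k T (vertex (hub 0))))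
                (Adj-sym necklace (adjacent first-apex))

  cycleSet : (Fin k → Fin p) → Subset N
  cycleSet T = setOf (cycleOf T)

  cycleSet-isCycleVertexSet : 1 ≤ k → ∀ T → IsCycleVertexSet necklace (cycleSet T)
  cycleSet-isCycleVertexSet 1≤k T = cycleOf T , cycleOf-isCycle 1≤k T , λ _ → ∈setOf⇔∈ (cycleOf T)

  apex∈cycleSet : ∀ T → apexV ∈ₛ cycleSet T
  apex∈cycleSet T = Equivalence.from (∈setOf⇔∈ (cycleOf T)) (∈-map⁺ vertex (there (apex∈ascent 0 k T)))

  cycleBeads : (Fin k → Fin p) → Subset N
  cycleBeads T = cycleSet T ∩ Λ

  beadVertex : (Fin k → Fin p) → Fin k → Fin N
  beadVertex T l = vertex (bead (toℕ l) (toℕ (T l)))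

  private
    bead<N : ∀ (T : Fin k → Fin p) l → bead (toℕ l) (toℕ (T l)) < N
    bead<N T l = <-trans (bead<apex {toℕ l} {toℕ (T l)} (toℕ<n l) (toℕ<n (T l))) apex<N

  beadVertex∈cycleBeads : ∀ T l → beadVertex T l ∈ₛ cycleBeads T
  beadVertex∈cycleBeads T l = x∈p∩q⁺ (in-cycle , in-Λ)
    where
    in-cycle = Equivalence.from (∈setOf⇔∈ (cycleOf T)) (∈-map⁺ vertex (there (bead∈ascent 0 k T l)))
    in-Λ = Equivalence.from (vertex∈Λ⇔isBead (bead<N T l)) (isBead-bead {toℕ l} (toℕ<n l) (toℕ<n (T l)))

  cycleBeads⊆beadVertices : ∀ T {v} → v ∈ₛ cycleBeads T → ∃ λ l → v ≡ beadVertex T l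
  cycleBeads⊆beadVertices T v∈
    with v∈cycle , v∈Λ ← x∈p∩q⁻ (cycleSet T) Λ v∈
    with y , y∈ , refl ← ∈-map⁻ vertex (Equivalence.to (∈setOf⇔∈ (cycleOf T)) v∈cycle)
    with l , refl ← cycleCodes-beads T y∈ (Equivalence.to (vertex∈Λ⇔isBead (cycleCodes<N T y∈)) v∈Λ)
    = l , refl

  ∣cycleBeads∣≡k : 1 ≤ k → ∀ T → ∣ cycleBeads T ∣ ≡ k
  ∣cycleBeads∣≡k 1≤k T =
    ≤-antisym at-most (apex-cycle-beads (cycleSet-isCycleVertexSet 1≤k T) (apex∈cycleSet T))
    where
    at-most : ∣ cycleBeads T ∣ ≤ k
    at-most = subst (∣ cycleBeads T ∣ ≤_) (trans (length-map (beadVertex T) (allFin k)) (length-tabulate id))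
      (⊆setOf⇒∣p∣≤length (map (beadVertex T) (allFin k)) λ v∈ →
         let l , v≡ = cycleBeads⊆beadVertices T v∈
         in subst (_∈ _) (sym v≡) (∈-map⁺ (beadVertex T) (∈-allFin l)))

  cycleBeads-injective : ∀ {T T′} → cycleBeads T ≡ cycleBeads T′ → ∀ l → T l ≡ T′ l
  cycleBeads-injective {T} {T′} same l
    with l′ , v≡ ← cycleBeads⊆beadVertices T′ (subst (beadVertex T l ∈ₛ_) same (beadVertex∈cycleBeads T l))
    with l≡l′ , Tl≡T′l′ ← bead-injective {toℕ l} {toℕ l′} (toℕ<n (T l)) (toℕ<n (T′ l′))
                            (vertex-injective (bead<N T l) (bead<N T′ l′) v≡)
    = toℕ-injective (trans Tl≡T′l′ (cong (toℕ ∘ T′) (sym (toℕ-injective l≡l′))))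

-- The hard instances

module HardInstances (p k L : ℕ) (1≤p : 1 ≤ p) (1≤k : 1 ≤ k) (k≤1+L : k ≤ suc L) where

  open Necklace p k public

  c : ℕ
  c = suc L ∸ k

  c+k≡1+L : c + k ≡ suc L
  c+k≡1+L = m∸n+n≡m k≤1+L

  c+[k∸1]≡L : c + (k ∸ 1) ≡ L
  c+[k∸1]≡L = suc-injective (begin
    suc (c + (k ∸ 1)) ≡⟨ +-suc c (k ∸ 1) ⟨
    c + suc (k ∸ 1)   ≡⟨ cong (c +_) (trans (+-comm 1 (k ∸ 1)) (m∸n+n≡m 1≤k)) ⟩
    c + k             ≡⟨ c+k≡1+L ⟩
    suc L             ∎)
    where open ≡-Reasoning

  penalty : Subset N → ℕ
  penalty X = if lookup X apexV then c else suc L + c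

  penalty-modular : Modular penalty
  penalty-modular = if∈-modular apexV c (suc L + c)

  f₀ : Subset N → ℕ
  f₀ X = penalty X + uniformRank k (X ∩ Λ)

  key : Fin (p ^ k) → Subset N
  key t = cycleBeads (finToFun t)

  f : Fin (p ^ k) → Subset N → ℕ
  f t X = penalty X + relaxedRank k (key t) (X ∩ Λ)

  f₀-submodular : Submodular f₀
  f₀-submodular = modular+submodular {f = penalty} penalty-modular
    (submodular-∘-∩ Λ {uniformRank k} (uniformRank-submodular k))

  f-submodular : ∀ t → Submodular (f t)
  f-submodular t = modular+submodular {f = penalty} penalty-modular
    (submodular-∘-∩ Λ {relaxedRank k (key t)}
      (relaxedRank-submodular k (key t) (∣cycleBeads∣≡k 1≤k (finToFun t))))

  penalty-apex : ∀ {X} → apexV ∈ₛ X → penalty X ≡ c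
  penalty-apex apex∈X rewrite []=⇒lookup apex∈X = refl

  -- Every cycle avoiding the apex pays the penalty suc L + c, above both L and suc L.
  bounded-on-cycles : ∀ (g : Subset N → ℕ) {v} →
                      (∀ {S} → IsCycleVertexSet necklace S → apexV ∈ₛ S → v ≤ c + g (S ∩ Λ)) →
                      v ≤ suc L →
                      ∀ S → IsCycleVertexSet necklace S → v ≤ penalty S + g (S ∩ Λ)
  bounded-on-cycles g through-apex v≤1+L S cycle with lookup S apexV in apex?
  ... | true  = through-apex cycle (lookup⇒[]= apexV S apex?)
  ... | false = ≤-trans v≤1+L (≤-trans (m≤m+n (suc L) c) (m≤m+n (suc L + c) (g (S ∩ Λ))))

  f₀-opt : IsOPT necklace f₀ (suc L)
  f₀-opt = (cycleSet T₀ , cycleSet-isCycleVertexSet 1≤k T₀ , at-T₀) ,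
           bounded-on-cycles (uniformRank k) through-apex ≤-refl
    where
    T₀ : Fin k → Fin p
    T₀ _ = fromℕ< 1≤p
    at-T₀ : f₀ (cycleSet T₀) ≡ suc L
    at-T₀ = begin
      penalty (cycleSet T₀) + ∣ cycleBeads T₀ ∣ ⊓ k ≡⟨ cong₂ _+_ (penalty-apex (apex∈cycleSet T₀))
                                                                 (cong (_⊓ k) (∣cycleBeads∣≡k 1≤k T₀)) ⟩
      c + k ⊓ k                                    ≡⟨ cong (c +_) (⊓-idem k) ⟩
      c + k                                        ≡⟨ c+k≡1+L ⟩
      suc L                                        ∎
      where open ≡-Reasoning
    through-apex : ∀ {S} → IsCycleVertexSet necklace S → apexV ∈ₛ S → suc L ≤ c + uniformRank k (S ∩ Λ)
    through-apex {S} cycle apex∈S =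
      subst (_≤ c + uniformRank k (S ∩ Λ)) c+k≡1+L
        (+-monoʳ-≤ c (≤-reflexive (sym (m≥n⇒m⊓n≡n (apex-cycle-beads cycle apex∈S)))))

  f-opt : ∀ t → IsOPT necklace (f t) L
  f-opt t = (cycleSet T , cycleSet-isCycleVertexSet 1≤k T , at-T) ,
            bounded-on-cycles (relaxedRank k (key t)) through-apex (n≤1+n L)
    where
    T = finToFun t
    at-T : f t (cycleSet T) ≡ L
    at-T = trans (cong₂ _+_ (penalty-apex (apex∈cycleSet T)) (relaxedRank-≡ k (key t))) c+[k∸1]≡L
    through-apex : ∀ {S} → IsCycleVertexSet necklace S → apexV ∈ₛ S → L ≤ c + relaxedRank k (key t) (S ∩ Λ)
    through-apex {S} cycle apex∈S =
      subst (_≤ c + relaxedRank k (key t) (S ∩ Λ)) c+[k∸1]≡L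
        (+-monoʳ-≤ c (k∸1≤relaxedRank k (key t) {S ∩ Λ} (apex-cycle-beads cycle apex∈S)))

  f-agrees : ∀ t {X} → X ∩ Λ ≢ key t → f t X ≡ f₀ X
  f-agrees t {X} X≢key = cong (penalty X +_) (relaxedRank-≢ k (key t) X≢key)

  key-injective : Injective _≡_ _≡_ key
  key-injective = finToFun-injective {k} {p} ∘ cycleBeads-injective

  queries-lower-bound : (A : Alg N) → Decides necklace L A → p ^ k ≤ queries A f₀
  queries-lower-bound A decides =
    adversary-bound _≟ₛ_ (_∩ Λ) key key-injective A f₀ f f-agrees λ t same → true≢false (begin
      true        ≡⟨ proj₁ (decides (f t) (f-submodular t)) (f-opt t) ⟨
      run A (f t) ≡⟨ same ⟩
      run A f₀    ≡⟨ proj₂ (decides f₀ f₀-submodular) f₀-opt ⟩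
      false       ∎)
    where
    open ≡-Reasoning
    true≢false : true ≢ false
    true≢false ()

k+2≤2^[1+k] : ∀ k → k + 2 ≤ 2 ^ suc k
k+2≤2^[1+k] zero    = ≤-refl
k+2≤2^[1+k] (suc k) = begin
  suc (k + 2)               ≤⟨ s≤s (k+2≤2^[1+k] k) ⟩
  suc (2 ^ suc k)           ≤⟨ +-monoˡ-≤ (2 ^ suc k) (m^n>0 2 (suc k)) ⟩
  2 ^ suc k + 2 ^ suc k     ≡⟨ cong (2 ^ suc k +_) (+-identityʳ (2 ^ suc k)) ⟨
  2 ^ suc (suc k)           ∎
  where open ≤-Reasoning

k≤1+[2^[1+k]∸2] : ∀ k → k ≤ suc (2 ^ suc k ∸ 2)
k≤1+[2^[1+k]∸2] k =
  ≤-trans (subst (_≤ 2 ^ suc k ∸ 2) (m+n∸n≡m k 2) (∸-monoˡ-≤ 2 (k+2≤2^[1+k] k))) (n≤1+n _)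

lemma4p3 : (p k : ℕ) → 1 ≤ p → 1 ≤ k →
    Σ (Graph (k * p + k + 2)) λ G →
      (A : Alg (k * p + k + 2)) → Decides G (2 ^ suc k ∸ 2) A →
        Σ (Subset (k * p + k + 2) → ℕ) λ f →
          Submodular f ×
          (IsOPT G f (2 ^ suc k ∸ 2) ⊎ IsOPT G f (suc (2 ^ suc k ∸ 2))) ×
          p ^ k ≤ queries A f
lemma4p3 p k 1≤p 1≤k =
  necklace , λ A decides → f₀ , f₀-submodular , inj₂ f₀-opt , queries-lower-bound A decides
  where open HardInstances p k (2 ^ suc k ∸ 2) 1≤p 1≤k (k≤1+[2^[1+k]∸2] k)
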